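{- Let $(\mathcal S,\chi)$ be an MR geometry and $G$ a green point. Suppose the lines through $G$ are: one line $\ell$ containing exactly $x$ green and exactly $y$ red points; $t$ further lines $\ell_1,\dots,\ell_t$ containing respectively exactly $g_1,\dots,g_t$ green points (and any number of red points); and all remaining lines through $G$ contain exactly one green point (namely $G$). Then $ty\le (t-1)(g(\mathcal S)-x)$. (In particular, $t\ge 2$.)
   Context: A finite linear space consists of a finite set of points and a set of lines (sets of points) such that any two distinct points lie on exactly one common line, every line has at least two points, and not all points are on one line. An MR geometry $(\mathcal S,\chi)$ is a finite linear space $\mathcal S$ with a colouring $\chi$ of each point red or green such that every line contains at least one red and at least one green point. $g(\mathcal S)$ denotes the number of green points of $\mathcal S$. -}

module Defs where

open import Data.Nat using (ℕ; _≤_)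
open import Data.Fin using (Fin)
open import Data.Fin.Subset using (Subset; _∈_; _∉_; _∩_; ∣_∣)
open import Data.Vec using (tabulate)
open import Data.Bool using (Bool; true; false)
open import Data.Product using (Σ; ∃; _×_)
open import Relation.Binary.PropositionalEquality using (_≡_; _≢_)

record LinearSpace (n m : ℕ) (L : Fin m → Subset n) : Set where
  field
    join      : ∀ (p q : Fin n) → p ≢ q → ∃ λ i → p ∈ L i × q ∈ L i
    joinUnique : ∀ (p q : Fin n) → p ≢ q → ∀ (i j : Fin m) →
                 p ∈ L i → q ∈ L i → p ∈ L j → q ∈ L j → i ≡ j
    lineSize  : ∀ (i : Fin m) → 2 ≤ ∣ L i ∣
    nonTrivial : ∀ (i : Fin m) → ∃ λ p → p ∉ L i

data Colour : Set where
  red green : Colour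

isGreen : Colour → Bool
isGreen red   = false
isGreen green = true

isRed : Colour → Bool
isRed red   = true
isRed green = false

greenSet : {n : ℕ} → (Fin n → Colour) → Subset n
greenSet χ = tabulate (λ p → isGreen (χ p))

redSet : {n : ℕ} → (Fin n → Colour) → Subset n
redSet χ = tabulate (λ p → isRed (χ p))

record MRGeometry (n m : ℕ) (L : Fin m → Subset n) (χ : Fin n → Colour) : Set where
  field
    linear   : LinearSpace n m L
    hasRed   : ∀ (i : Fin m) → ∃ λ p → p ∈ L i × χ p ≡ red
    hasGreen : ∀ (i : Fin m) → ∃ λ p → p ∈ L i × χ p ≡ green

g : {n : ℕ} → (Fin n → Colour) → ℕ
g χ = ∣ greenSet χ ∣

greensOn : {n : ℕ} → (Fin n → Colour) → Subset n → ℕ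
greensOn χ ℓ = ∣ ℓ ∩ greenSet χ ∣

redsOn : {n : ℕ} → (Fin n → Colour) → Subset n → ℕ
redsOn χ ℓ = ∣ ℓ ∩ redSet χ ∣

-- Let A be the set of green points off ℓ, so ∣A∣ = g − x. Joining G to a point of A gives a
-- line through G with two green points, hence one of the ℓᵢ: ∣A∣ ≤ Σᵢ ∣A ∩ ℓᵢ∣. Conversely,
-- fix a red point Q on ℓᵢ. For every red R on ℓ the line RQ carries a green point, which lies
-- neither on ℓ nor on ℓᵢ (these meet only in the green point G), and distinct R give distinct
-- such points: ∣A ∖ ℓᵢ∣ ≥ y. Summing ∣A∣ = ∣A ∩ ℓᵢ∣ + ∣A ∖ ℓᵢ∣ over i gives t∣A∣ ≥ ∣A∣ + ty.

module Submission where

open import Defs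
open import Data.Nat using (ℕ; zero; suc; _+_)
open import Data.Fin using (Fin; zero; suc; _≟_)
open import Data.Fin.Subset using (Subset; _∈_; _∉_; _∩_; ∁; ∣_∣; inside; outside)
open import Data.Fin.Subset.Properties using (x∈p∩q⁺; x∈p∩q⁻; x∈∁p⇒x∉p; x∉p⇒x∈∁p)
open import Data.Product as Product using (∃; _,_; proj₁; proj₂)
open import Relation.Nullary.Decidable using (decidable-stable)
open import Function using (_∘_)
open import Function.Definitions using (Injective)
open import Relation.Binary.PropositionalEquality

module Cardinality where

  open import Data.Nat using (_≤_; z≤n; s≤s)
  open import Data.Nat.Properties
    using (≤-trans; ≤-reflexive; +-suc; +-mono-≤; +-0-commutativeMonoid; module ≤-Reasoning)
  open import Algebra.Properties.CommutativeMonoid.Sum +-0-commutativeMonoid using (sum-syntax)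
  open import Data.Vec using ([]; _∷_; here; there)
  open import Data.Fin.Properties using (¬Fin0)
  open import Data.Fin.Subset using (_-_; Empty; _⊂_)
  open import Data.Fin.Subset.Properties
    using (Empty-unique; ∣⊥∣≡0; nonempty?; p─⊥≡p; p─q⊆p; ∣p∩q∣≤∣p∣;
           x∈p∧x≢y⇒x∈p-y; x∈p⇒p-x⊂p; x∈p⇒∣p-x∣<∣p∣)
  open import Data.Fin.Subset.Induction using (Acc; acc; ⊂-wellFounded)
  open import Data.Empty using (⊥-elim)
  open import Relation.Nullary using (yes; no)

  private
    variable
      n : ℕ
      p q : Subset n
      x y : Fin n

  ∣p∣≡∣q∩p∣+∣∁q∩p∣ : ∀ (p q : Subset n) → ∣ p ∣ ≡ ∣ q ∩ p ∣ + ∣ ∁ q ∩ p ∣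
  ∣p∣≡∣q∩p∣+∣∁q∩p∣ []            []            = refl
  ∣p∣≡∣q∩p∣+∣∁q∩p∣ (inside  ∷ p) (inside  ∷ q) = cong suc (∣p∣≡∣q∩p∣+∣∁q∩p∣ p q)
  ∣p∣≡∣q∩p∣+∣∁q∩p∣ (inside  ∷ p) (outside ∷ q) =
    trans (cong suc (∣p∣≡∣q∩p∣+∣∁q∩p∣ p q)) (sym (+-suc _ _))
  ∣p∣≡∣q∩p∣+∣∁q∩p∣ (outside ∷ p) (inside  ∷ q) = ∣p∣≡∣q∩p∣+∣∁q∩p∣ p q
  ∣p∣≡∣q∩p∣+∣∁q∩p∣ (outside ∷ p) (outside ∷ q) = ∣p∣≡∣q∩p∣+∣∁q∩p∣ p q

  Empty⇒∣p∣≡0 : Empty p → ∣ p ∣ ≡ 0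
  Empty⇒∣p∣≡0 {n} empty = trans (cong ∣_∣ (Empty-unique empty)) (∣⊥∣≡0 n)

  x∈p⇒∣p∣≡1+∣p-x∣ : x ∈ p → ∣ p ∣ ≡ suc ∣ p - x ∣
  x∈p⇒∣p∣≡1+∣p-x∣ {p = _ ∷ p}       here        = cong (suc ∘ ∣_∣) (sym (p─⊥≡p p))
  x∈p⇒∣p∣≡1+∣p-x∣ {p = inside  ∷ _} (there x∈p) = cong suc (x∈p⇒∣p∣≡1+∣p-x∣ x∈p)
  x∈p⇒∣p∣≡1+∣p-x∣ {p = outside ∷ _} (there x∈p) = x∈p⇒∣p∣≡1+∣p-x∣ x∈p

  x∉p-x : x ∉ p - x
  x∉p-x {x = zero}  {p = _ ∷ _} ()
  x∉p-x {x = suc _} {p = _ ∷ _} (there x∈p-x) = x∉p-x x∈p-x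

  x∈p-y⇒x≢y : x ∈ p - y → x ≢ y
  x∈p-y⇒x≢y x∈p-x refl = x∉p-x x∈p-x

  x∈p∧y∈p∧x≢y⇒2≤∣p∣ : x ∈ p → y ∈ p → x ≢ y → 2 ≤ ∣ p ∣
  x∈p∧y∈p∧x≢y⇒2≤∣p∣ {p = p} x∈p y∈p x≢y = begin
    2               ≤⟨ s≤s (≤-trans (s≤s z≤n) (x∈p⇒∣p-x∣<∣p∣ (x∈p∧x≢y⇒x∈p-y y∈p (x≢y ∘ sym)))) ⟩
    suc ∣ p - _ ∣   ≡⟨ sym (x∈p⇒∣p∣≡1+∣p-x∣ x∈p) ⟩
    ∣ p ∣           ∎
    where open ≤-Reasoning

  record Injection (p q : Subset n) : Set where
    field
      to           : ∀ {x} → x ∈ p → Fin n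
      to-∈         : ∀ {x} (x∈p : x ∈ p) → to x∈p ∈ q
      to-injective : ∀ {x y} (x∈p : x ∈ p) (y∈p : y ∈ p) → to x∈p ≡ to y∈p → x ≡ y

  restrict : (f : Injection p q) (x∈p : x ∈ p) → Injection (p - x) (q - Injection.to f x∈p)
  restrict {p = p} {x = x} f x∈p = record
    { to           = to ∘ ⊆p
    ; to-∈         = λ y∈p-x → x∈p∧x≢y⇒x∈p-y (to-∈ (⊆p y∈p-x))
                                  (x∈p-y⇒x≢y y∈p-x ∘ to-injective (⊆p y∈p-x) x∈p)
    ; to-injective = λ y∈p-x z∈p-x → to-injective (⊆p y∈p-x) (⊆p z∈p-x)
    }
    where
    open Injection f
    ⊆p = p─q⊆p p _

  Injection⇒∣p∣≤∣q∣ : Injection p q → ∣ p ∣ ≤ ∣ q ∣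
  Injection⇒∣p∣≤∣q∣ = go (⊂-wellFounded _)
    where
    go : Acc _⊂_ p → Injection p q → ∣ p ∣ ≤ ∣ q ∣
    go {p = p} {q = q} (acc smaller) f with nonempty? p
    ... | no  p-empty   = ≤-trans (≤-reflexive (Empty⇒∣p∣≡0 p-empty)) z≤n
    ... | yes (x , x∈p) = begin
      ∣ p ∣                           ≡⟨ x∈p⇒∣p∣≡1+∣p-x∣ x∈p ⟩
      suc ∣ p - x ∣                   ≤⟨ s≤s (go (smaller (x∈p⇒p-x⊂p x∈p)) (restrict f x∈p)) ⟩
      suc ∣ q - Injection.to f x∈p ∣  ≤⟨ x∈p⇒∣p-x∣<∣p∣ (Injection.to-∈ f x∈p) ⟩
      ∣ q ∣                           ∎
      where open ≤-Reasoning

  ∣p∣≤∑∣qᵢ∣ : ∀ {t} (q : Fin t → Subset n) → (∀ {x} → x ∈ p → ∃ λ i → x ∈ q i) →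
              ∣ p ∣ ≤ ∑[ i < t ] ∣ q i ∣
  ∣p∣≤∑∣qᵢ∣ {t = zero} q cover =
    ≤-reflexive (Empty⇒∣p∣≡0 (λ (_ , x∈p) → ¬Fin0 (proj₁ (cover x∈p))))
  ∣p∣≤∑∣qᵢ∣ {p = p} {t = suc t} q cover = begin
    ∣ p ∣                                 ≡⟨ ∣p∣≡∣q∩p∣+∣∁q∩p∣ p (q zero) ⟩
    ∣ q zero ∩ p ∣ + ∣ ∁ (q zero) ∩ p ∣   ≤⟨ +-mono-≤ (∣p∩q∣≤∣p∣ (q zero) p) (∣p∣≤∑∣qᵢ∣ (q ∘ suc) cover′) ⟩
    ∣ q zero ∣ + ∑[ i < t ] ∣ q (suc i) ∣ ∎
    where
    open ≤-Reasoning
    cover′ : ∀ {x} → x ∈ ∁ (q zero) ∩ p → ∃ λ i → x ∈ q (suc i)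
    cover′ x∈∁q₀∩p with x∈p∩q⁻ (∁ (q zero)) p x∈∁q₀∩p
    ... | x∈∁q₀ , x∈p with cover x∈p
    ...   | zero  , x∈q₀ = ⊥-elim (x∈∁p⇒x∉p x∈∁q₀ x∈q₀)
    ...   | suc i , x∈qᵢ = i , x∈qᵢ

module Arithmetic where

  open import Data.Nat using (_*_; _∸_; _≤_; z≤n)
  open import Data.Nat.Properties
    using (≤-trans; ≤-reflexive; +-comm; +-mono-≤; +-cancelˡ-≤; m≤m+n; m+n∸m≡n;
           +-0-commutativeMonoid; module ≤-Reasoning)
  open import Algebra.Properties.CommutativeMonoid.Sum +-0-commutativeMonoid
    using (sum-syntax; ∑-distrib-+; sum-cong-≗)
  import Data.Integer as ℤ
  open import Data.Integer.Properties using (pos-*; [+m]-[+n]≡m⊖n; ⊖-≥)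

  ∑-const : ∀ t m → ∑[ i < t ] m ≡ t * m
  ∑-const zero    m = refl
  ∑-const (suc t) m = cong (m +_) (∑-const t m)

  ∑-mono-≤ : ∀ {t} {f g : Fin t → ℕ} → (∀ i → f i ≤ g i) → ∑[ i < t ] f i ≤ ∑[ i < t ] g i
  ∑-mono-≤ {zero}  f≤g = z≤n
  ∑-mono-≤ {suc t} f≤g = +-mono-≤ (f≤g zero) (∑-mono-≤ (f≤g ∘ suc))

  double-count : ∀ {t a y} (b c : Fin t → ℕ) → (∀ i → b i + c i ≡ a) →
                 a ≤ ∑[ i < t ] b i → (∀ i → y ≤ c i) → t * y + a ≤ t * a
  double-count {t} {a} {y} b c b+c≡a a≤∑b y≤c = begin
    t * y + a                       ≡⟨ cong (_+ a) (sym (∑-const t y)) ⟩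
    ∑[ i < t ] y + a                ≤⟨ +-mono-≤ (∑-mono-≤ y≤c) a≤∑b ⟩
    ∑[ i < t ] c i + ∑[ i < t ] b i ≡⟨ +-comm (∑[ i < t ] c i) _ ⟩
    ∑[ i < t ] b i + ∑[ i < t ] c i ≡⟨ sym (∑-distrib-+ b c) ⟩
    ∑[ i < t ] (b i + c i)          ≡⟨ sum-cong-≗ b+c≡a ⟩
    ∑[ i < t ] a                    ≡⟨ ∑-const t a ⟩
    t * a                           ∎
    where open ≤-Reasoning

  m*n+o≤m*o⇒m*n≤[m-1]*o : ∀ m n o → m * n + o ≤ m * o →
                           ℤ.+ m ℤ.* ℤ.+ n ℤ.≤ (ℤ.+ m ℤ.- ℤ.+ 1) ℤ.* ℤ.+ o
  m*n+o≤m*o⇒m*n≤[m-1]*o zero    n zero    _  = ℤ.+≤+ z≤n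
  m*n+o≤m*o⇒m*n≤[m-1]*o zero    n (suc o) ()
  -- ℤ.+ (suc m) ℤ.- ℤ.+ 1 computes to ℤ.+ m.
  m*n+o≤m*o⇒m*n≤[m-1]*o (suc m) n o mn+o≤mo = subst₂ ℤ._≤_ (pos-* (suc m) n) (pos-* m o)
    (ℤ.+≤+ (+-cancelˡ-≤ o _ _ (≤-trans (≤-reflexive (+-comm o _)) mn+o≤mo)))

  +[m+n]-+m≡+n : ∀ m n → ℤ.+ (m + n) ℤ.- ℤ.+ m ≡ ℤ.+ n
  +[m+n]-+m≡+n m n = begin
    ℤ.+ (m + n) ℤ.- ℤ.+ m ≡⟨ [+m]-[+n]≡m⊖n (m + n) m ⟩
    (m + n) ℤ.⊖ m         ≡⟨ ⊖-≥ (m≤m+n m n) ⟩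
    ℤ.+ (m + n ∸ m)       ≡⟨ cong ℤ.+_ (m+n∸m≡n m n) ⟩
    ℤ.+ n                 ∎
    where open ≡-Reasoning

module Colouring {n : ℕ} (χ : Fin n → Colour) where

  open import Data.Bool using (true)
  open import Data.Vec using (tabulate)
  open import Data.Vec.Properties using (lookup∘tabulate; []=⇒lookup; lookup⇒[]=)

  private
    variable
      p q : Fin n

    isRed⇒≡red : ∀ c → isRed c ≡ true → c ≡ red
    isRed⇒≡red red _ = refl

  green⇒∈greenSet : χ p ≡ green → p ∈ greenSet χ
  green⇒∈greenSet {p} χp≡green =
    lookup⇒[]= p _ (trans (lookup∘tabulate (isGreen ∘ χ) p) (cong isGreen χp≡green))

  ∈redSet⇒red : p ∈ redSet χ → χ p ≡ red
  ∈redSet⇒red {p} p∈red =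
    isRed⇒≡red (χ p) (trans (sym (lookup∘tabulate (isRed ∘ χ) p)) ([]=⇒lookup p∈red))

  green≢red : χ p ≡ green → χ q ≡ red → p ≢ q
  green≢red χp≡green χq≡red refl with trans (sym χp≡green) χq≡red
  ... | ()

module LinearSpaceProperties {n m : ℕ} {L : Fin m → Subset n} (S : LinearSpace n m L) where

  open LinearSpace S

  meet-unique : ∀ {i j p q} → i ≢ j → p ∈ L i → p ∈ L j → q ∈ L i → q ∈ L j → p ≡ q
  meet-unique {i} {j} {p} {q} i≢j p∈i p∈j q∈i q∈j =
    decidable-stable (p ≟ q) (λ p≢q → i≢j (joinUnique p q p≢q i j p∈i q∈i p∈j q∈j))

module MRGeometryProperties {n m : ℕ} {L : Fin m → Subset n} {χ : Fin n → Colour}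
                            (MR : MRGeometry n m L χ) where

  open import Data.Nat using (_≤_)
  open import Data.Nat.Properties using (<-irrefl)
  open import Data.Fin.Properties using (any?)
  open MRGeometry MR
  open LinearSpace linear
  open LinearSpaceProperties linear
  open Colouring χ
  open Cardinality using (Injection; Injection⇒∣p∣≤∣q∣; x∈p∧y∈p∧x≢y⇒2≤∣p∣)

  greensOff : Fin m → Subset n
  greensOff k = ∁ (L k) ∩ greenSet χ

  private
    variable
      i j : Fin m
      G : Fin n

  red∈i⇒∉j : i ≢ j → G ∈ L i → G ∈ L j → χ G ≡ green →
             ∀ {p} → p ∈ L i → χ p ≡ red → p ∉ L j
  red∈i⇒∉j i≢j G∈i G∈j G-green p∈i p-red p∈j =
    green≢red G-green p-red (meet-unique i≢j G∈i G∈j p∈i p∈j)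

  redsOn≤greensOffBoth : i ≢ j → G ∈ L i → G ∈ L j → χ G ≡ green →
                         redsOn χ (L i) ≤ ∣ ∁ (L j) ∩ greensOff i ∣
  redsOn≤greensOffBoth {i} {j} i≢j G∈i G∈j G-green = Injection⇒∣p∣≤∣q∣ (record
    { to           = P
    ; to-∈         = P-off
    ; to-injective = P-injective
    })
    where
    Q     = proj₁ (hasRed j)
    Q∈j   = proj₁ (proj₂ (hasRed j))
    Q-red = proj₂ (proj₂ (hasRed j))
    Q∉i : Q ∉ L i
    Q∉i = red∈i⇒∉j (i≢j ∘ sym) G∈j G∈i G-green Q∈j Q-red

    module _ {R : Fin n} (R∈ : R ∈ L i ∩ redSet χ) where
      R∈i   = proj₁ (x∈p∩q⁻ (L i) _ R∈)
      R-red = ∈redSet⇒red (proj₂ (x∈p∩q⁻ (L i) _ R∈))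
      R∉j : R ∉ L j
      R∉j = red∈i⇒∉j i≢j G∈i G∈j G-green R∈i R-red
      R≢Q : R ≢ Q
      R≢Q refl = Q∉i R∈i

      M   = proj₁ (join R Q R≢Q)
      R∈M = proj₁ (proj₂ (join R Q R≢Q))
      Q∈M = proj₂ (proj₂ (join R Q R≢Q))
      M≢i : M ≢ i
      M≢i M≡i = Q∉i (subst (λ k → Q ∈ L k) M≡i Q∈M)
      M≢j : M ≢ j
      M≢j M≡j = R∉j (subst (λ k → R ∈ L k) M≡j R∈M)

      P       = proj₁ (hasGreen M)
      P∈M     = proj₁ (proj₂ (hasGreen M))
      P-green = proj₂ (proj₂ (hasGreen M))
      P-off : P ∈ ∁ (L j) ∩ greensOff i
      P-off = x∈p∩q⁺ (x∉p⇒x∈∁p P∉j , x∈p∩q⁺ (x∉p⇒x∈∁p P∉i , green⇒∈greenSet P-green))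
        where
        P∉i : P ∉ L i
        P∉i P∈i = green≢red P-green R-red (meet-unique M≢i P∈M P∈i R∈M R∈i)
        P∉j : P ∉ L j
        P∉j P∈j = green≢red P-green Q-red (meet-unique M≢j P∈M P∈j Q∈M Q∈j)

    P-injective : ∀ {R R′} (R∈ : R ∈ L i ∩ redSet χ) (R′∈ : R′ ∈ L i ∩ redSet χ) →
                  P R∈ ≡ P R′∈ → R ≡ R′
    P-injective {R′ = R′} R∈ R′∈ P≡P′ = meet-unique (M≢i R∈) (R∈M R∈) (R∈i R∈) R′∈M (R∈i R′∈)
      where
      M≡M′ : M R∈ ≡ M R′∈
      M≡M′ = joinUnique (P R∈) Q (green≢red (P-green R∈) Q-red) (M R∈) (M R′∈)
               (P∈M R∈) (Q∈M R∈) (subst (_∈ L (M R′∈)) (sym P≡P′) (P∈M R′∈)) (Q∈M R′∈)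
      R′∈M : R′ ∈ L (M R∈)
      R′∈M = subst (λ k → R′ ∈ L k) (sym M≡M′) (R∈M R′∈)

  greensOff-covered : ∀ {ℓ t} (ℓs : Fin t → Fin m) → G ∈ L ℓ → χ G ≡ green →
    (∀ k → G ∈ L k → k ≢ ℓ → (∀ i → k ≢ ℓs i) → greensOn χ (L k) ≡ 1) →
    ∀ {P} → P ∈ greensOff ℓ → ∃ λ i → P ∈ L (ℓs i)
  greensOff-covered {G} {ℓ} ℓs G∈ℓ G-green one-green {P} P∈ =
    Product.map₂ (λ k≡ℓsᵢ → subst (λ k → P ∈ L k) k≡ℓsᵢ P∈k) k∈ℓs
    where
    P∉ℓ = x∈∁p⇒x∉p (proj₁ (x∈p∩q⁻ (∁ (L ℓ)) _ P∈))
    G≢P : G ≢ P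
    G≢P refl = P∉ℓ G∈ℓ
    k   = proj₁ (join G P G≢P)
    G∈k = proj₁ (proj₂ (join G P G≢P))
    P∈k = proj₂ (proj₂ (join G P G≢P))
    k≢ℓ : k ≢ ℓ
    k≢ℓ k≡ℓ = P∉ℓ (subst (λ k → P ∈ L k) k≡ℓ P∈k)
    two-greens : 2 ≤ greensOn χ (L k)
    two-greens = x∈p∧y∈p∧x≢y⇒2≤∣p∣ (x∈p∩q⁺ (G∈k , green⇒∈greenSet G-green))
                                     (x∈p∩q⁺ (P∈k , proj₂ (x∈p∩q⁻ (∁ (L ℓ)) _ P∈))) G≢P
    k∈ℓs : ∃ λ i → k ≡ ℓs i
    k∈ℓs = decidable-stable (any? (λ i → k ≟ ℓs i)) λ k∉ℓs →
      <-irrefl refl (subst (2 ≤_) (one-green k G∈k k≢ℓ (λ i → k∉ℓs ∘ (i ,_))) two-greens)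

open Cardinality using (∣p∣≡∣q∩p∣+∣∁q∩p∣; ∣p∣≤∑∣qᵢ∣)
open Arithmetic using (double-count; m*n+o≤m*o⇒m*n≤[m-1]*o; +[m+n]-+m≡+n)
import Data.Nat as ℕ
open import Data.Nat.Properties using (+-0-commutativeMonoid)
open import Algebra.Properties.CommutativeMonoid.Sum +-0-commutativeMonoid using (sum-syntax)
open import Data.Integer using (ℤ; +_; _-_; _*_; _≤_)

lemma3p1 : ∀ (n m : ℕ) (L : Fin m → Subset n) (χ : Fin n → Colour) →
    MRGeometry n m L χ →
    ∀ (G : Fin n) → χ G ≡ green →
    ∀ (x y : ℕ) (ℓ : Fin m) → G ∈ L ℓ → greensOn χ (L ℓ) ≡ x → redsOn χ (L ℓ) ≡ y →
    ∀ (t : ℕ) (ℓs : Fin t → Fin m) (gs : Fin t → ℕ) →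
    Injective _≡_ _≡_ ℓs →
    (∀ (i : Fin t) → ℓs i ≢ ℓ) →
    (∀ (i : Fin t) → G ∈ L (ℓs i)) →
    (∀ (i : Fin t) → greensOn χ (L (ℓs i)) ≡ gs i) →
    (∀ (k : Fin m) → G ∈ L k → k ≢ ℓ → (∀ (i : Fin t) → k ≢ ℓs i) →
      greensOn χ (L k) ≡ 1) →
    (+ t) * (+ y) ≤ (+ t - + 1) * (+ g χ - + x)
lemma3p1 n m L χ MR G G-green x y ℓ G∈ℓ greens-ℓ reds-ℓ t ℓs _ _ ℓs≢ℓ G∈ℓs _ one-green =
  subst (λ d → + t * + y ≤ (+ t - + 1) * d) (sym g-x≡a)
    (m*n+o≤m*o⇒m*n≤[m-1]*o t y a (double-count b c b+c≡a a≤∑b y≤c))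
  where
  open MRGeometryProperties MR
  A = greensOff ℓ
  a = ∣ A ∣
  b c : Fin t → ℕ
  b i = ∣ L (ℓs i) ∩ A ∣
  c i = ∣ ∁ (L (ℓs i)) ∩ A ∣

  g≡x+a : g χ ≡ x + a
  g≡x+a = trans (∣p∣≡∣q∩p∣+∣∁q∩p∣ (greenSet χ) (L ℓ)) (cong (_+ a) greens-ℓ)
  g-x≡a : + g χ - + x ≡ + a
  g-x≡a = trans (cong (λ k → + k - + x) g≡x+a) (+[m+n]-+m≡+n x a)
  b+c≡a : ∀ i → b i + c i ≡ a
  b+c≡a i = sym (∣p∣≡∣q∩p∣+∣∁q∩p∣ A (L (ℓs i)))
  a≤∑b : a ℕ.≤ ∑[ i < t ] b i
  a≤∑b = ∣p∣≤∑∣qᵢ∣ (λ i → L (ℓs i) ∩ A) (λ P∈A →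
           Product.map₂ (λ P∈ℓsᵢ → x∈p∩q⁺ (P∈ℓsᵢ , P∈A)) (greensOff-covered ℓs G∈ℓ G-green one-green P∈A))
  y≤c : ∀ i → y ℕ.≤ c i
  y≤c i = subst (ℕ._≤ c i) reds-ℓ (redsOn≤greensOffBoth (ℓs≢ℓ i ∘ sym) G∈ℓ (G∈ℓs i) G-green)
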